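{- Let $\mathbb{H}$ be a finite $\tau$-structure with universe $H$ and $J\subseteq H$. If $\mathbb{H}$ dismantles to a substructure $\mathbb{I}$ whose universe contains $J$ and such that $\mathbb{I}^2$ dismantles to its diagonal, then $C(\mathbb{G},\mathbb{H})$ is $J$-connected for every locally finite $\tau$-structure $\mathbb{G}$.
   Context: A signature $\tau$ is a set of relation symbols with arities; a $\tau$-structure has a countable universe and relations $R(\cdot)\subseteq(\text{universe})^k$ for $k$-ary $R\in\tau$. Homomorphisms are maps preserving every relation componentwise; $\mathrm{Hom}(\mathbb{G},\mathbb{H})$ is their set. $b$ dominates $a$ in $\mathbb{H}$ if for every $k$-ary $R$, every $i$, and every $(a_1,\dots,a_k)\in R(\mathbb{H})$ with $a_i=a$, $(a_1,\dots,a_{i-1},b,a_{i+1},\dots,a_k)\in R(\mathbb{H})$. $\mathbb{J}_0$ dismantles to $\mathbb{J}_\ell$ if there is a sequence $\mathbb{J}_0,\dots,\mathbb{J}_\ell$ ($\ell\ge0$) where each $\mathbb{J}_{j+1}$ is the substructure of $\mathbb{J}_j$ induced by $J_j\setminus\{a_j\}$ for some $a_j$ dominated in $\mathbb{J}_j$ by some $b_j\neq a_j$. $\mathbb{I}^2$ is the product structure on $I\times I$ and its diagonal is the substructure induced by $\{(a,a):a\in I\}$. $\mathbb{G}$ is locally finite if each element lies in finitely many tuples. $C(\mathbb{G},\mathbb{H})$ is the graph on $\mathrm{Hom}(\mathbb{G},\mathbb{H})$ with $\phi,\psi$ adjacent iff they differ on at most one element. A sequence $\phi_1,\dots,\phi_t$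 is $J$-preserving if for every $x$ with $\phi_1(x)=\phi_t(x)=a\in J$, $\phi_i(x)=a$ for all $i$. $C(\mathbb{G},\mathbb{H})$ is $J$-connected if any two homomorphisms agreeing on all but finitely many elements of $G$ are joined by a $J$-preserving walk in it. -}

module Defs where

open import Level using (0ℓ)
open import Data.Nat using (ℕ; suc)
open import Data.Fin using (Fin; zero; suc; fromℕ; inject₁)
open import Data.Vec using (Vec; map; lookup; _[_]≔_)
open import Data.Vec.Membership.Propositional as VecMem using ()
open import Data.List using (List)
open import Data.List.Membership.Propositional as ListMem using ()
open import Data.Product using (Σ; ∃; ∃-syntax; _×_; _,_; proj₁; proj₂)
open import Function using (_∘_; Injective)
open import Relation.Binary.PropositionalEquality using (_≡_; _≢_)
open import Relation.Unary using (Pred; _⊆_)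

record Signature : Set₁ where
  field
    Sym   : Set
    arity : Sym → ℕ
open Signature public

record Structure (τ : Signature) : Set₁ where
  field
    Carrier : Set
    rel     : (R : Sym τ) → Vec Carrier (arity τ R) → Set
open Structure public

Countable : ∀ {τ} → Structure τ → Set
Countable 𝔸 = Σ (Carrier 𝔸 → ℕ) Injective′
  where Injective′ = λ f → Injective _≡_ _≡_ f

LocallyFinite : ∀ {τ} → Structure τ → Set
LocallyFinite {τ} 𝔾 =
  (x : Carrier 𝔾) →
  ∃[ L ] ((R : Sym τ) (t : Vec (Carrier 𝔾) (arity τ R)) →
          rel 𝔾 R t → x VecMem.∈ t →
          ListMem._∈_ {A = Σ (Sym τ) (λ R′ → Vec (Carrier 𝔾) (arity τ R′))}
            (R , t) L)

_² : ∀ {τ} → Structure τ → Structure τ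
𝔸 ² = record
  { Carrier = Carrier 𝔸 × Carrier 𝔸
  ; rel     = λ R t → rel 𝔸 R (map proj₁ t) × rel 𝔸 R (map proj₂ t)
  }

-- b dominates a in the substructure of 𝔸 induced by S.
Dominates : ∀ {τ} (𝔸 : Structure τ) → Pred (Carrier 𝔸) 0ℓ →
            Carrier 𝔸 → Carrier 𝔸 → Set
Dominates {τ} 𝔸 S a b =
  (R : Sym τ) (t : Vec (Carrier 𝔸) (arity τ R)) →
  (∀ i → S (lookup t i)) → rel 𝔸 R t →
  (i : Fin (arity τ R)) → lookup t i ≡ a → rel 𝔸 R (t [ i ]≔ b)

-- Dismantles 𝔸 S T : the substructure of 𝔸 induced by S dismantles to
-- the substructure of 𝔸 induced by T.
data Dismantles {τ} (𝔸 : Structure τ) :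
       Pred (Carrier 𝔸) 0ℓ → Pred (Carrier 𝔸) 0ℓ → Set₁ where
  done : ∀ {S T} → S ⊆ T → T ⊆ S → Dismantles 𝔸 S T
  step : ∀ {S T} (a b : Carrier 𝔸) → S a → S b → a ≢ b →
         Dominates 𝔸 S a b →
         Dismantles 𝔸 (λ x → S x × x ≢ a) T →
         Dismantles 𝔸 S T

IsHom : ∀ {τ} (𝔾 ℍ : Structure τ) → (Carrier 𝔾 → Carrier ℍ) → Set
IsHom {τ} 𝔾 ℍ f =
  (R : Sym τ) (t : Vec (Carrier 𝔾) (arity τ R)) →
  rel 𝔾 R t → rel ℍ R (map f t)

Hom : ∀ {τ} (𝔾 ℍ : Structure τ) → Set
Hom 𝔾 ℍ = Σ (Carrier 𝔾 → Carrier ℍ) (IsHom 𝔾 ℍ)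

Adjacent : ∀ {τ} {𝔾 ℍ : Structure τ} → Hom 𝔾 ℍ → Hom 𝔾 ℍ → Set
Adjacent {𝔾 = 𝔾} φ ψ =
  ∃[ x ] ((y : Carrier 𝔾) → y ≢ x → proj₁ φ y ≡ proj₁ ψ y)

record JWalk {τ} {𝔾 ℍ : Structure τ} (J : Pred (Carrier ℍ) 0ℓ)
             (φ ψ : Hom 𝔾 ℍ) : Set where
  field
    len      : ℕ
    seq      : Fin (suc len) → Hom 𝔾 ℍ
    start    : ∀ x → proj₁ (seq zero) x ≡ proj₁ φ x
    end      : ∀ x → proj₁ (seq (fromℕ len)) x ≡ proj₁ ψ x
    adjacent : (i : Fin len) → Adjacent {𝔾 = 𝔾} {ℍ = ℍ} (seq (inject₁ i)) (seq (suc i))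
    preserve : (x : Carrier 𝔾) (a : Carrier ℍ) →
               proj₁ (seq zero) x ≡ a → proj₁ (seq (fromℕ len)) x ≡ a →
               J a → (i : Fin (suc len)) → proj₁ (seq i) x ≡ a

JConnected : ∀ {τ} (𝔾 ℍ : Structure τ) → Pred (Carrier ℍ) 0ℓ → Set
JConnected 𝔾 ℍ J =
  (φ ψ : Hom 𝔾 ℍ) →
  (∃[ F ] ((x : Carrier 𝔾) → ¬∈ x F → proj₁ φ x ≡ proj₁ ψ x)) →
  JWalk {𝔾 = 𝔾} {ℍ = ℍ} J φ ψ
  where
    open import Relation.Nullary using (¬_)
    ¬∈ : Carrier 𝔾 → List (Carrier 𝔾) → Set
    ¬∈ x F = ¬ (x ListMem.∈ F)

-- A dismantling of ℍ to 𝕀 gives a retraction ℍ → 𝕀 as a composite of folds, each sending a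
-- dominated vertex to its dominator. Applying the j-th fold to a homomorphism only on the ball
-- of radius N − j around the finite set F where φ and ψ differ keeps every intermediate map a
-- homomorphism: a tuple touched by a fold has all its entries in the current substructure, so
-- domination applies, and the vertices of the ball can be updated one at a time. Thus φ and ψ
-- are joined to maps φ′, ψ′ with values in 𝕀 near F that still agree outside F. The pair
-- (φ′, ψ′) is a homomorphism into ℍ², and dismantling 𝕀² to its diagonal in the same layered
-- way moves it to a pair of equal maps; the two projections of that walk join φ′ to ψ′. Folds
-- never move values in the target of the dismantling, which gives J-preservation as J ⊆ I.
module Submission where

open import Defs
open import Level using (0ℓ)
open import Data.Nat using (ℕ)
open import Data.Fin using (Fin)
open import Data.Product using (_×_; proj₁; proj₂)
open import Data.Unit using (⊤)
open import Function.Bundles using (_↔_)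
open import Relation.Binary.PropositionalEquality using (_≡_)
open import Relation.Unary using (Pred; _⊆_)

open import Data.Nat using (zero; suc; pred; _≤_; _<_; z≤n; s≤s; _∸_; _+_; _<?_)
import Data.Nat.Properties as ℕₚ
open import Data.Fin using (zero; suc; fromℕ; inject₁)
import Data.Fin.Properties as Finₚ
open import Data.Vec using (Vec; map; lookup; _[_]≔_; toList)
import Data.Vec.Properties as Vecₚ
open import Data.Vec.Relation.Binary.Pointwise.Extensional using (ext; Pointwise-≡⇒≡)
import Data.Vec.Membership.Propositional.Properties as VecMemₚ
open import Data.List using (List; []; _∷_; _++_; concatMap; allFin)
open import Data.List.Membership.Propositional using (_∈_; _∉_)
import Data.List.Membership.Propositional.Properties as ListMemₚ
open import Data.List.Relation.Unary.Any as Any using (here; there)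
open import Data.Product using (∃-syntax; _,_)
import Data.Product.Properties as Productₚ
open import Data.Sum using (_⊎_; inj₁; inj₂; map₂)
open import Data.Empty using (⊥-elim)
open import Data.Unit using (tt)
open import Function using (_∘_)
open import Function.Bundles using (mk↣)
open import Function.Properties.Inverse using (↔⇒↣)
open import Relation.Nullary using (yes; no)
open import Relation.Binary.Definitions using (DecidableEquality)
open import Relation.Binary.PropositionalEquality
  using (_≢_; _≗_; refl; sym; trans; cong; cong₂; subst; module ≡-Reasoning)

IsHom-resp-≗ : ∀ {τ} {G K : Structure τ} {f g : Carrier G → Carrier K} →
               f ≗ g → IsHom G K f → IsHom G K g
IsHom-resp-≗ {K = K} f≗g hf R t r = subst (rel K R) (Vecₚ.map-cong f≗g t) (hf R t r)

IsHom-∘ : ∀ {τ} {G K L : Structure τ} {f : Carrier G → Carrier K} {g : Carrier K → Carrier L} →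
          IsHom K L g → IsHom G K f → IsHom G L (g ∘ f)
IsHom-∘ {L = L} {f} {g} hg hf R t r = subst (rel L R) (sym (Vecₚ.map-∘ g f t)) (hg R _ (hf R t r))

proj₁-hom : ∀ {τ} {K : Structure τ} → IsHom (K ²) K proj₁
proj₁-hom R t = proj₁

proj₂-hom : ∀ {τ} {K : Structure τ} → IsHom (K ²) K proj₂
proj₂-hom R t = proj₂

pair-hom : ∀ {τ} {G K : Structure τ} {f g : Carrier G → Carrier K} →
           IsHom G K f → IsHom G K g → IsHom G (K ²) (λ x → f x , g x)
pair-hom {K = K} hf hg R t r =
  subst (rel K R) (Vecₚ.map-∘ proj₁ _ t) (hf R t r) ,
  subst (rel K R) (Vecₚ.map-∘ proj₂ _ t) (hg R t r)

AdjacentMaps : ∀ {τ} (G K : Structure τ) (f g : Carrier G → Carrier K) → Set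
AdjacentMaps G K f g = ∃[ x ] (∀ y → y ≢ x → f y ≡ g y)

data Walk {τ} (G K : Structure τ) (P : Pred (Carrier G → Carrier K) 0ℓ) :
          (Carrier G → Carrier K) → (Carrier G → Carrier K) → Set where
  nil  : ∀ {f g} → f ≗ g → IsHom G K f → P f → Walk G K P f g
  cons : ∀ {f h g} → IsHom G K f → P f → AdjacentMaps G K f h → Walk G K P h g →
         Walk G K P f g

module _ {τ} {G K : Structure τ} {P : Pred (Carrier G → Carrier K) 0ℓ} where

  first : ∀ {f g} → Walk G K P f g → IsHom G K f × P f
  first (nil _ hf pf)    = hf , pf
  first (cons hf pf _ _) = hf , pf

  lastHom : ∀ {f g} → Walk G K P f g → IsHom G K g
  lastHom (nil f≗g hf _) = IsHom-resp-≗ {G = G} {K = K} f≗g hf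
  lastHom (cons _ _ _ w) = lastHom w

  endWith : ∀ {f g g′} → Walk G K P f g → g ≗ g′ → Walk G K P f g′
  endWith (nil f≗g hf pf)    g≗g′ = nil (λ x → trans (f≗g x) (g≗g′ x)) hf pf
  endWith (cons hf pf adj w) g≗g′ = cons hf pf adj (endWith w g≗g′)

  startWith : ∀ {f f′ g} → IsHom G K f → P f → f ≗ f′ → Walk G K P f′ g → Walk G K P f g
  startWith hf pf f≗f′ (nil f′≗g _ _) = nil (λ x → trans (f≗f′ x) (f′≗g x)) hf pf
  startWith hf pf f≗f′ (cons _ _ (x , adj) w) =
    cons hf pf (x , λ y y≢x → trans (f≗f′ y) (adj y y≢x)) w

  infixr 5 _++ʷ_
  _++ʷ_ : ∀ {f h g} → Walk G K P f h → Walk G K P h g → Walk G K P f g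
  nil f≗h hf pf    ++ʷ w′ = startWith hf pf f≗h w′
  cons hf pf adj w ++ʷ w′ = cons hf pf adj (w ++ʷ w′)

  reverse : (∀ {f g} → f ≗ g → P f → P g) → ∀ {f g} → Walk G K P f g → Walk G K P g f
  reverse resp (nil f≗g hf pf) = nil (sym ∘ f≗g) (IsHom-resp-≗ {G = G} {K = K} f≗g hf) (resp f≗g pf)
  reverse resp (cons hf pf (x , adj) w) =
    reverse resp w ++ʷ
    cons (proj₁ (first w)) (proj₂ (first w)) (x , λ y y≢x → sym (adj y y≢x)) (nil (λ _ → refl) hf pf)

  mapPred : ∀ {Q : Pred (Carrier G → Carrier K) 0ℓ} → (∀ {χ} → P χ → Q χ) →
            ∀ {f g} → Walk G K P f g → Walk G K Q f g
  mapPred P⇒Q (nil f≗g hf pf)    = nil f≗g hf (P⇒Q pf)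
  mapPred P⇒Q (cons hf pf adj w) = cons hf (P⇒Q pf) adj (mapPred P⇒Q w)

  length : ∀ {f g} → Walk G K P f g → ℕ
  length (nil _ _ _)    = 0
  length (cons _ _ _ w) = suc (length w)

  vertex : ∀ {f g} (w : Walk G K P f g) → Fin (suc (length w)) → Hom G K
  vertex (nil {f = f} _ hf _)    zero    = f , hf
  vertex (cons {f = f} hf _ _ _) zero    = f , hf
  vertex (cons _ _ _ w)          (suc i) = vertex w i

  vertex-P : ∀ {f g} (w : Walk G K P f g) i → P (proj₁ (vertex w i))
  vertex-P (nil _ _ pf)    zero    = pf
  vertex-P (cons _ pf _ _) zero    = pf
  vertex-P (cons _ _ _ w)  (suc i) = vertex-P w i

  vertex-first : ∀ {f g} (w : Walk G K P f g) → proj₁ (vertex w zero) ≗ f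
  vertex-first (nil _ _ _)    _ = refl
  vertex-first (cons _ _ _ _) _ = refl

  vertex-last : ∀ {f g} (w : Walk G K P f g) → proj₁ (vertex w (fromℕ (length w))) ≗ g
  vertex-last (nil f≗g _ _)  = f≗g
  vertex-last (cons _ _ _ w) = vertex-last w

  vertex-adjacent : ∀ {f g} (w : Walk G K P f g) (i : Fin (length w)) →
                    Adjacent {𝔾 = G} {ℍ = K} (vertex w (inject₁ i)) (vertex w (suc i))
  vertex-adjacent (cons _ _ (x , adj) w) zero =
    x , λ y y≢x → trans (adj y y≢x) (sym (vertex-first w y))
  vertex-adjacent (cons _ _ _ w) (suc i) = vertex-adjacent w i

mapWalk : ∀ {τ} {G K K′ : Structure τ} {P : Pred (Carrier G → Carrier K) 0ℓ}
          {Q : Pred (Carrier G → Carrier K′) 0ℓ} (π : Carrier K → Carrier K′) →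
          IsHom K K′ π → (∀ {χ} → P χ → Q (π ∘ χ)) →
          ∀ {f g} → Walk G K P f g → Walk G K′ Q (π ∘ f) (π ∘ g)
mapWalk {G = G} {K} {K′} π hπ P⇒Q (nil f≗g hf pf) =
  nil (cong π ∘ f≗g) (IsHom-∘ {G = G} {K} {K′} hπ hf) (P⇒Q pf)
mapWalk {G = G} {K} {K′} π hπ P⇒Q (cons hf pf (x , adj) w) =
  cons (IsHom-∘ {G = G} {K} {K′} hπ hf) (P⇒Q pf) (x , λ y y≢x → cong π (adj y y≢x))
       (mapWalk π hπ P⇒Q w)

Fixes : ∀ {A B : Set} → Pred B 0ℓ → (A → B) → Pred (A → B) 0ℓ
Fixes T θ χ = ∀ x → T (θ x) → χ x ≡ θ x

Preserving : ∀ {A B : Set} → Pred B 0ℓ → (f g : A → B) → Pred (A → B) 0ℓ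
Preserving J f g χ = ∀ x a → f x ≡ a → g x ≡ a → J a → χ x ≡ a

module _ {A B : Set} {I : Pred B 0ℓ} {f g χ : A → B} where

  Preserving-resp-≗ : ∀ {χ′} → χ ≗ χ′ → Preserving I f g χ → Preserving I f g χ′
  Preserving-resp-≗ χ≗χ′ p x a fx≡a gx≡a Ia = trans (sym (χ≗χ′ x)) (p x a fx≡a gx≡a Ia)

  Preserving-mono : ∀ {J} → J ⊆ I → Preserving I f g χ → Preserving J f g χ
  Preserving-mono J⊆I p x a fx≡a gx≡a Ja = p x a fx≡a gx≡a (J⊆I Ja)

  Fixes⇒Preservingˡ : Fixes I f χ → Preserving I f g χ
  Fixes⇒Preservingˡ fix x a fx≡a _ Ia = trans (fix x (subst I (sym fx≡a) Ia)) fx≡a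

  Fixes⇒Preservingʳ : Fixes I g χ → Preserving I f g χ
  Fixes⇒Preservingʳ fix x a _ gx≡a Ia = trans (fix x (subst I (sym gx≡a) Ia)) gx≡a

  Preserving-Fixes : ∀ {f′ g′} → Fixes I f f′ → Fixes I g g′ →
                     Preserving I f′ g′ χ → Preserving I f g χ
  Preserving-Fixes fix-f fix-g p x a fx≡a gx≡a Ia =
    p x a (trans (fix-f x (subst I (sym fx≡a) Ia)) fx≡a)
          (trans (fix-g x (subst I (sym gx≡a) Ia)) gx≡a) Ia

toJWalk : ∀ {τ} {G H : Structure τ} {J : Pred (Carrier H) 0ℓ} {φ ψ : Hom G H} →
          Walk G H (Preserving J (proj₁ φ) (proj₁ ψ)) (proj₁ φ) (proj₁ ψ) →
          JWalk {𝔾 = G} {ℍ = H} J φ ψ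
toJWalk w = record
  { len      = length w
  ; seq      = vertex w
  ; start    = vertex-first w
  ; end      = vertex-last w
  ; adjacent = vertex-adjacent w
  ; preserve = λ x a first≡a last≡a Ja i →
      vertex-P w i x a (trans (sym (vertex-first w x)) first≡a)
                       (trans (sym (vertex-last w x)) last≡a) Ja
  }

steps : ∀ {τ} {K : Structure τ} {S T : Pred (Carrier K) 0ℓ} → Dismantles K S T → ℕ
steps (done _ _)           = 0
steps (step _ _ _ _ _ _ D) = suc (steps D)

target⊆source : ∀ {τ} {K : Structure τ} {S T : Pred (Carrier K) 0ℓ} → Dismantles K S T → T ⊆ S
target⊆source (done _ T⊆S)         = T⊆S
target⊆source (step _ _ _ _ _ _ D) = λ Tc → proj₁ (target⊆source D Tc)

-- The entries are moved one position at a time, each move being an instance of domination.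
replaceDominated : ∀ {τ} {K : Structure τ} {S : Pred (Carrier K) 0ℓ} {a b} →
  Dominates K S a b → S b → ∀ {R} {u v : Vec (Carrier K) (arity τ R)} →
  rel K R u → (∀ i → S (lookup u i)) →
  (∀ i → lookup v i ≡ lookup u i ⊎ (lookup u i ≡ a × lookup v i ≡ b)) → rel K R v
replaceDominated {τ} {K} {S} {a} {b} a-dom-b Sb {R} r Su moved =
  go (allFin _) r Su (λ i → map₂ (ListMemₚ.∈-allFin i ,_) (moved i))
  where
    MovedAt : List (Fin (arity τ R)) → (u v : Vec (Carrier K) (arity τ R)) → Set
    MovedAt ps u v = ∀ i → lookup v i ≡ lookup u i ⊎ (i ∈ ps × lookup u i ≡ a × lookup v i ≡ b)

    go : ∀ ps {u v} → rel K R u → (∀ i → S (lookup u i)) → MovedAt ps u v → rel K R v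
    go [] {u} {v} r Su moved = subst (rel K R) (Pointwise-≡⇒≡ (ext unmoved)) r
      where
        unmoved : ∀ i → lookup u i ≡ lookup v i
        unmoved i with moved i
        ... | inj₁ vi≡ui     = sym vi≡ui
        ... | inj₂ (() , _)
    go (p ∷ ps) {u} {v} r Su moved with moved p
    ... | inj₁ vp≡up = go ps r Su moved′
      where
        moved′ : MovedAt ps u v
        moved′ i with moved i
        ... | inj₁ vi≡ui                  = inj₁ vi≡ui
        ... | inj₂ (here refl , _)        = inj₁ vp≡up
        ... | inj₂ (there i∈ps , ui≡a , vi≡b) = inj₂ (i∈ps , ui≡a , vi≡b)
    go (p ∷ ps) {u} {v} r Su moved | inj₂ (_ , up≡a , vp≡b) =
      go ps (a-dom-b R u Su r p up≡a) Su′ moved′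
      where
        Su′ : ∀ i → S (lookup (u [ p ]≔ b) i)
        Su′ i with i Finₚ.≟ p
        ... | yes refl = subst S (sym (Vecₚ.lookup∘update p u b)) Sb
        ... | no i≢p   = subst S (sym (Vecₚ.lookup∘update′ i≢p u b)) (Su i)
        moved′ : MovedAt ps (u [ p ]≔ b) v
        moved′ i with i Finₚ.≟ p
        ... | yes refl = inj₁ (trans vp≡b (sym (Vecₚ.lookup∘update p u b)))
        ... | no i≢p with moved i
        ...   | inj₁ vi≡ui = inj₁ (trans vi≡ui (sym (Vecₚ.lookup∘update′ i≢p u b)))
        ...   | inj₂ (here i≡p , _) = ⊥-elim (i≢p i≡p)
        ...   | inj₂ (there i∈ps , ui≡a , vi≡b) =
                  inj₂ (i∈ps , trans (Vecₚ.lookup∘update′ i≢p u b) ui≡a , vi≡b)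

module Folding {τ} {K : Structure τ} (_≟_ : DecidableEquality (Carrier K)) where

  fold : (a b c : Carrier K) → Carrier K
  fold a b c with c ≟ a
  ... | yes _ = b
  ... | no _  = c

  fold-≢ : ∀ {a b c} → c ≢ a → fold a b c ≡ c
  fold-≢ {a} {b} {c} c≢a with c ≟ a
  ... | yes c≡a = ⊥-elim (c≢a c≡a)
  ... | no _    = refl

  fold-cases : ∀ a b c → fold a b c ≡ c ⊎ (c ≡ a × fold a b c ≡ b)
  fold-cases a b c with c ≟ a
  ... | yes c≡a = inj₂ (c≡a , refl)
  ... | no _    = inj₁ refl

  fold-∈ : ∀ {S : Pred (Carrier K) 0ℓ} {a b c} → S c → S b → b ≢ a →
           S (fold a b c) × fold a b c ≢ a
  fold-∈ {a = a} {c = c} Sc Sb b≢a with c ≟ a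
  ... | yes _ = Sb , b≢a
  ... | no c≢a = Sc , c≢a

  retract : ∀ {S T} → Dismantles K S T → ℕ → Carrier K → Carrier K
  retract D                      zero    c = c
  retract (done _ _)             (suc n) c = c
  retract (step a b _ _ _ _ D) (suc n) c = retract D n (fold a b c)

  retract-fixes : ∀ {S T} (D : Dismantles K S T) n {c} → T c → retract D n c ≡ c
  retract-fixes D                    zero    Tc = refl
  retract-fixes (done _ _)           (suc n) Tc = refl
  retract-fixes (step a b _ _ _ _ D) (suc n) Tc =
    trans (cong (retract D n) (fold-≢ (proj₂ (target⊆source D Tc)))) (retract-fixes D n Tc)

  retract-fixes-active : ∀ {S T} (D : Dismantles K S T) n {c} → (0 < n → T c) → retract D n c ≡ c
  retract-fixes-active D zero    _      = refl
  retract-fixes-active D (suc n) active = retract-fixes D (suc n) (active (s≤s z≤n))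

  retract-lands : ∀ {S T} (D : Dismantles K S T) {n c} → S c → steps D ≤ n → T (retract D n c)
  retract-lands (done S⊆T _) {zero}  Sc _ = S⊆T Sc
  retract-lands (done S⊆T _) {suc n} Sc _ = S⊆T Sc
  retract-lands (step a b _ Sb a≢b _ D) {suc n} Sc (s≤s D≤n) =
    retract-lands D (fold-∈ Sc Sb (a≢b ∘ sym)) D≤n

module Staged {τ} (G K : Structure τ) (_≟G_ : DecidableEquality (Carrier G))
              (_≟K_ : DecidableEquality (Carrier K)) where

  open Folding {K = K} _≟K_ public

  -- l x is the number of folds still to be applied at x.
  Graded : Pred (Carrier K) 0ℓ → (Carrier G → Carrier K) → (Carrier G → ℕ) → Set
  Graded S θ l = ∀ R t → rel G R t →
    (∀ i → l (lookup t i) ≡ 0) ⊎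
    ((∀ i → S (θ (lookup t i))) × (∀ i j → l (lookup t i) ≤ suc (l (lookup t j))))

  Between : (θ θ′ χ : Carrier G → Carrier K) → Set
  Between θ θ′ χ = ∀ x → χ x ≡ θ x ⊎ χ x ≡ θ′ x

  override : Carrier G → (θ′ χ : Carrier G → Carrier K) → Carrier G → Carrier K
  override y θ′ χ x with x ≟G y
  ... | yes _ = θ′ x
  ... | no _  = χ x

  walkBetweenFrom : ∀ {P θ θ′} → (∀ χ → Between θ θ′ χ → IsHom G K χ × P χ) →
    (L : List (Carrier G)) (χ : Carrier G → Carrier K) → Between θ θ′ χ →
    (∀ x → x ∈ L ⊎ χ x ≡ θ′ x) → Walk G K P χ θ′
  walkBetweenFrom {θ′ = θ′} ok [] χ bχ pending =
    nil (λ x → settled (pending x)) (proj₁ (ok χ bχ)) (proj₂ (ok χ bχ))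
    where
      settled : ∀ {x} → x ∈ [] ⊎ χ x ≡ θ′ x → χ x ≡ θ′ x
      settled (inj₂ χx≡θ′x) = χx≡θ′x
  walkBetweenFrom {θ = θ} {θ′} ok (y ∷ L) χ bχ pending =
    cons (proj₁ (ok χ bχ)) (proj₂ (ok χ bχ)) (y , unchanged)
         (walkBetweenFrom ok L (override y θ′ χ) bχ′ pending′)
    where
      unchanged : ∀ z → z ≢ y → χ z ≡ override y θ′ χ z
      unchanged z z≢y with z ≟G y
      ... | yes z≡y = ⊥-elim (z≢y z≡y)
      ... | no _    = refl
      bχ′ : Between θ θ′ (override y θ′ χ)
      bχ′ x with x ≟G y
      ... | yes _ = inj₂ refl
      ... | no _  = bχ x
      pending′ : ∀ x → x ∈ L ⊎ override y θ′ χ x ≡ θ′ x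
      pending′ x with x ≟G y | pending x
      ... | yes _   | _                 = inj₂ refl
      ... | no _    | inj₂ χx≡θ′x       = inj₂ χx≡θ′x
      ... | no x≢y  | inj₁ (here x≡y)   = ⊥-elim (x≢y x≡y)
      ... | no _    | inj₁ (there x∈L)  = inj₁ x∈L

  walkBetween : ∀ {P θ θ′} → (∀ χ → Between θ θ′ χ → IsHom G K χ × P χ) →
    (L : List (Carrier G)) → (∀ x → x ∈ L ⊎ θ x ≡ θ′ x) → Walk G K P θ θ′
  walkBetween {θ = θ} ok L = walkBetweenFrom ok L θ (λ _ → inj₁ refl)

  module OneFold {S : Pred (Carrier K) 0ℓ} {a b : Carrier K} (Sb : S b) (a≢b : a ≢ b)
                 (a-dom-b : Dominates K S a b) (θ : Carrier G → Carrier K) (hθ : IsHom G K θ)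
                 (l : Carrier G → ℕ) (graded : Graded S θ l) where

    foldIfPending : ℕ → Carrier K → Carrier K
    foldIfPending zero    c = c
    foldIfPending (suc _) c = fold a b c

    θ′ : Carrier G → Carrier K
    θ′ x = foldIfPending (l x) (θ x)

    θ′-cases : ∀ x → θ′ x ≡ θ x ⊎ (θ x ≡ a × θ′ x ≡ b)
    θ′-cases x with l x
    ... | zero  = inj₁ refl
    ... | suc _ = fold-cases a b (θ x)

    between-cases : ∀ {χ} → Between θ θ′ χ → ∀ x → χ x ≡ θ x ⊎ (θ x ≡ a × χ x ≡ b)
    between-cases bχ x with bχ x | θ′-cases x
    ... | inj₁ χx≡θx  | _                     = inj₁ χx≡θx
    ... | inj₂ χx≡θ′x | inj₁ θ′x≡θx            = inj₁ (trans χx≡θ′x θ′x≡θx)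
    ... | inj₂ χx≡θ′x | inj₂ (θx≡a , θ′x≡b)    = inj₂ (θx≡a , trans χx≡θ′x θ′x≡b)

    between-idle : ∀ {χ} → Between θ θ′ χ → ∀ x → l x ≡ 0 → χ x ≡ θ x
    between-idle bχ x lx≡0 with bχ x
    ... | inj₁ χx≡θx  = χx≡θx
    ... | inj₂ χx≡θ′x = trans χx≡θ′x (cong (λ n → foldIfPending n (θ x)) lx≡0)

    between-hom : ∀ χ → Between θ θ′ χ → IsHom G K χ
    between-hom χ bχ R t r with graded R t r
    ... | inj₁ idle = subst (rel K R) (Pointwise-≡⇒≡ (ext same)) (hθ R t r)
      where
        same : ∀ i → lookup (map θ t) i ≡ lookup (map χ t) i
        same i rewrite Vecₚ.lookup-map i θ t | Vecₚ.lookup-map i χ t =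
          sym (between-idle bχ (lookup t i) (idle i))
    ... | inj₂ (inS , _) = replaceDominated a-dom-b Sb (hθ R t r) Su moved
      where
        Su : ∀ i → S (lookup (map θ t) i)
        Su i = subst S (sym (Vecₚ.lookup-map i θ t)) (inS i)
        moved : ∀ i → lookup (map χ t) i ≡ lookup (map θ t) i ⊎
                      (lookup (map θ t) i ≡ a × lookup (map χ t) i ≡ b)
        moved i rewrite Vecₚ.lookup-map i θ t | Vecₚ.lookup-map i χ t =
          between-cases bχ (lookup t i)

    between-fixes : ∀ {T} → (∀ {c} → T c → c ≢ a) → ∀ χ → Between θ θ′ χ → Fixes T θ χ
    between-fixes a∉T χ bχ x Tθx with between-cases bχ x
    ... | inj₁ χx≡θx      = χx≡θx
    ... | inj₂ (θx≡a , _) = ⊥-elim (a∉T Tθx θx≡a)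

    Fixes-θ′ : ∀ {T} → (∀ {c} → T c → c ≢ a) → ∀ {χ} → Fixes T θ′ χ → Fixes T θ χ
    Fixes-θ′ {T} a∉T fix x Tθx = trans (fix x (subst T (sym θ′x≡θx) Tθx)) θ′x≡θx
      where θ′x≡θx = between-fixes a∉T θ′ (λ _ → inj₂ refl) x Tθx

    pending : ∀ {L} → (∀ x → 0 < l x → x ∈ L) → ∀ x → x ∈ L ⊎ θ x ≡ θ′ x
    pending support x with l x in eq
    ... | zero  = inj₂ refl
    ... | suc _ = inj₁ (support x (subst (0 <_) (sym eq) (s≤s z≤n)))

    graded′ : Graded (λ c → S c × c ≢ a) θ′ (pred ∘ l)
    graded′ R t r with graded R t r
    ... | inj₁ idle = inj₁ (λ i → cong pred (idle i))
    ... | inj₂ (inS , close) with Finₚ.any? (λ j → l (lookup t j) ℕₚ.≟ 0)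
    ...   | yes (j , lj≡0) = inj₁ λ i →
              ℕₚ.n≤0⇒n≡0 (subst (pred (l (lookup t i)) ≤_) lj≡0 (ℕₚ.pred-mono-≤ (close i j)))
    ...   | no noneIdle = inj₂ (inS′ , λ i j → pred-close (close i j))
      where
        inS′ : ∀ i → S (θ′ (lookup t i)) × θ′ (lookup t i) ≢ a
        inS′ i with l (lookup t i) in eq
        ... | zero  = ⊥-elim (noneIdle (i , eq))
        ... | suc _ = fold-∈ (inS i) Sb (a≢b ∘ sym)
        pred-close : ∀ {m n} → m ≤ suc n → pred m ≤ suc (pred n)
        pred-close {n = zero}  m≤1   = ℕₚ.m≤n⇒m≤1+n (ℕₚ.pred-mono-≤ m≤1)
        pred-close {n = suc n} m≤2+n = ℕₚ.pred-mono-≤ m≤2+n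

  retractWalk : ∀ {S T} (D : Dismantles K S T) (θ : Carrier G → Carrier K) → IsHom G K θ →
    (l : Carrier G → ℕ) (L : List (Carrier G)) → (∀ x → 0 < l x → x ∈ L) → Graded S θ l →
    Walk G K (Fixes T θ) θ (λ x → retract D (l x) (θ x))
  retractWalk (done S⊆T T⊆S) θ hθ l L support graded = nil unchanged hθ (λ _ _ → refl)
    where
      unchanged : ∀ x → θ x ≡ retract (done S⊆T T⊆S) (l x) (θ x)
      unchanged x with l x
      ... | zero  = refl
      ... | suc _ = refl
  retractWalk {T = T} D₀@(step a b _ Sb a≢b a-dom-b D) θ hθ l L support graded =
    endWith (walkBetween (λ χ bχ → between-hom χ bχ , between-fixes a∉T χ bχ) L (pending support)
             ++ʷ mapPred (Fixes-θ′ a∉T)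
                   (retractWalk D θ′ (between-hom θ′ (λ _ → inj₂ refl)) (pred ∘ l) L support′ graded′))
            unfold
    where
      open OneFold Sb a≢b a-dom-b θ hθ l graded
      a∉T : ∀ {c} → T c → c ≢ a
      a∉T Tc = proj₂ (target⊆source D Tc)
      support′ : ∀ x → 0 < pred (l x) → x ∈ L
      support′ x p = support x (ℕₚ.<-≤-trans p ℕₚ.pred[n]≤n)
      unfold : ∀ x → retract D (pred (l x)) (θ′ x) ≡ retract D₀ (l x) (θ x)
      unfold x with l x
      ... | zero  = refl
      ... | suc _ = refl

module Levels {A : Set} (_≟_ : DecidableEquality A) where

  open import Data.List.Membership.DecPropositional _≟_ using (_∈?_)

  -- level C N x = N ∸ k for the least k < N with x ∈ C k, and 0 if there is none.
  level : (ℕ → List A) → ℕ → A → ℕ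
  level C zero    x = 0
  level C (suc N) x with x ∈? C 0
  ... | yes _ = suc N
  ... | no _  = level (C ∘ suc) N x

  level-≤ : ∀ C N x → level C N x ≤ N
  level-≤ C zero    x = z≤n
  level-≤ C (suc N) x with x ∈? C 0
  ... | yes _ = ℕₚ.≤-refl
  ... | no _  = ℕₚ.m≤n⇒m≤1+n (level-≤ (C ∘ suc) N x)

  level-∈₀ : ∀ C N x → x ∈ C 0 → level C N x ≡ N
  level-∈₀ C zero    x _   = refl
  level-∈₀ C (suc N) x x∈ with x ∈? C 0
  ... | yes _ = refl
  ... | no x∉ = ⊥-elim (x∉ x∈)

  level-adjacent : ∀ C N x y → (∀ k → x ∈ C k → y ∈ C (suc k)) → level C N x ≤ suc (level C N y)
  level-adjacent C zero    x y _ = z≤n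
  level-adjacent C (suc N) x y x↝y with x ∈? C 0 | y ∈? C 0
  ... | yes _  | yes _ = ℕₚ.n≤1+n _
  ... | yes x∈ | no _  rewrite level-∈₀ (C ∘ suc) N y (x↝y 0 x∈) = ℕₚ.≤-refl
  ... | no _   | yes _ = ℕₚ.m≤n⇒m≤1+n (ℕₚ.m≤n⇒m≤1+n (level-≤ (C ∘ suc) N x))
  ... | no _   | no _  = level-adjacent (C ∘ suc) N x y (x↝y ∘ suc)

  level-support : ∀ C N x → (∀ {j k} → j ≤ k → x ∈ C j → x ∈ C k) → 0 < level C N x → x ∈ C N
  level-support C (suc N) x mono active with x ∈? C 0
  ... | yes x∈ = mono z≤n x∈
  ... | no _   = level-support (C ∘ suc) N x (mono ∘ s≤s) active

  level-full : ∀ C N x j → x ∈ C j → N ∸ j ≤ level C N x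
  level-full C zero    x j _ = ℕₚ.≤-reflexive (ℕₚ.0∸n≡0 j)
  level-full C (suc N) x j x∈ with x ∈? C 0
  ... | yes _ = ℕₚ.m∸n≤m (suc N) j
  level-full C (suc N) x zero    x∈ | no x∉ = ⊥-elim (x∉ x∈)
  level-full C (suc N) x (suc j) x∈ | no _  = level-full (C ∘ suc) N x j x∈

module Balls {τ} (G : Structure τ) (lf : LocallyFinite G) where

  neighbours : Carrier G → List (Carrier G)
  neighbours x = concatMap (toList ∘ proj₂) (proj₁ (lf x))

  neighbours-∋ : ∀ {R t} → rel G R t → ∀ i j → lookup t j ∈ neighbours (lookup t i)
  neighbours-∋ {R} {t} r i j =
    ListMemₚ.∈-concatMap⁺ (toList ∘ proj₂)
      (Any.map (λ { refl → VecMemₚ.∈-toList⁺ (VecMemₚ.∈-lookup j t) })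
        (proj₂ (lf (lookup t i)) R t r (VecMemₚ.∈-lookup i t)))

  ball : List (Carrier G) → ℕ → List (Carrier G)
  ball F zero    = F
  ball F (suc k) = ball F k ++ concatMap neighbours (ball F k)

  ball-grow : ∀ {F j x} d → x ∈ ball F j → x ∈ ball F (d + j)
  ball-grow zero    x∈ = x∈
  ball-grow (suc d) x∈ = ListMemₚ.∈-++⁺ˡ (ball-grow d x∈)

  ball-mono : ∀ {F j k x} → j ≤ k → x ∈ ball F j → x ∈ ball F k
  ball-mono {F} {j} {k} {x} j≤k x∈ =
    subst (λ n → x ∈ ball F n) (ℕₚ.m∸n+n≡m j≤k) (ball-grow (k ∸ j) x∈)

  ball-step : ∀ F k {R t} → rel G R t → ∀ i j →
              lookup t i ∈ ball F k → lookup t j ∈ ball F (suc k)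
  ball-step F k r i j ti∈ =
    ListMemₚ.∈-++⁺ʳ (ball F k)
      (ListMemₚ.∈-concatMap⁺ neighbours (Any.map (λ { refl → neighbours-∋ r i j }) ti∈))

module Reconfiguration {τ} (G K : Structure τ) (_≟G_ : DecidableEquality (Carrier G))
       (_≟K_ : DecidableEquality (Carrier K)) (lf : LocallyFinite G) (F : List (Carrier G)) where

  open Balls G lf
  open Levels _≟G_
  open import Data.List.Membership.DecPropositional _≟G_ using (_∈?_)
  module S₁ = Staged G K _≟G_ _≟K_
  module S₂ = Staged G (K ²) _≟G_ (Productₚ.≡-dec _≟K_ _≟K_)

  active⇒∈ball : ∀ N {x} → 0 < level (ball F) N x → x ∈ ball F N
  active⇒∈ball N {x} = level-support (ball F) N x ball-mono

  levels-close : ∀ N {R t} → rel G R t → ∀ i j →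
                 level (ball F) N (lookup t i) ≤ suc (level (ball F) N (lookup t j))
  levels-close N r i j = level-adjacent (ball F) N _ _ (λ k → ball-step F k r i j)

  module _ {I : Pred (Carrier K) 0ℓ} (D : Dismantles K (λ _ → ⊤) I) (k : ℕ) where

    retractNear : (Carrier G → Carrier K) → Carrier G → Carrier K
    retractNear χ x = S₁.retract D (level (ball F) (steps D + k) x) (χ x)

    retractNear-∈ : ∀ χ {x} → x ∈ ball F k → I (retractNear χ x)
    retractNear-∈ χ {x} x∈ = S₁.retract-lands D tt
      (subst (_≤ level (ball F) (steps D + k) x) (ℕₚ.m+n∸n≡m (steps D) k)
             (level-full (ball F) (steps D + k) x k x∈))

    retractNear-fixes : ∀ χ → Fixes I χ (retractNear χ)
    retractNear-fixes χ x Iχx = S₁.retract-fixes D (level (ball F) (steps D + k) x) Iχx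

    retractNear-cong : ∀ χ₁ χ₂ {x} → χ₁ x ≡ χ₂ x → retractNear χ₁ x ≡ retractNear χ₂ x
    retractNear-cong χ₁ χ₂ {x} = cong (S₁.retract D (level (ball F) (steps D + k) x))

    walkToRetractNear : ∀ χ → IsHom G K χ → Walk G K (Fixes I χ) χ (retractNear χ)
    walkToRetractNear χ hχ =
      S₁.retractWalk D χ hχ (level (ball F) N) (ball F N) (λ _ → active⇒∈ball N)
                     (λ R t r → inj₂ ((λ _ → tt) , levels-close N r))
      where N = steps D + k

  module _ {I : Pred (Carrier K) 0ℓ}
           (D : Dismantles (K ²) (λ p → I (proj₁ p) × I (proj₂ p))
                                 (λ p → I (proj₁ p) × proj₁ p ≡ proj₂ p))
           (χ₁ χ₂ : Carrier G → Carrier K) (hχ₁ : IsHom G K χ₁) (hχ₂ : IsHom G K χ₂)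
           (agree : ∀ x → x ∉ F → χ₁ x ≡ χ₂ x)
           (near : ∀ x → x ∈ ball F (suc (steps D)) → I (χ₁ x) × I (χ₂ x)) where

    private
      m : ℕ
      m = steps D
      θ : Carrier G → Carrier K × Carrier K
      θ x = χ₁ x , χ₂ x
      l : Carrier G → ℕ
      l = level (ball F) m
      θ* : Carrier G → Carrier K × Carrier K
      θ* x = S₂.retract D (l x) (θ x)

      graded : S₂.Graded (λ p → I (proj₁ p) × I (proj₂ p)) θ l
      graded R t r with Finₚ.any? (λ i → 0 <? l (lookup t i))
      ... | yes (i , active) =
              inj₂ ((λ j → near _ (ball-step F m r i j (active⇒∈ball m active))) , levels-close m r)
      ... | no noneActive = inj₁ (λ i → ℕₚ.n≤0⇒n≡0 (ℕₚ.≮⇒≥ (λ p → noneActive (i , p))))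

      diagonal : ∀ x → proj₁ (θ* x) ≡ proj₂ (θ* x)
      diagonal x with x ∈? F
      ... | yes x∈F = proj₂ (S₂.retract-lands D {n = l x} (near x (ball-mono {k = suc m} z≤n x∈F))
                                                 (level-full (ball F) m x 0 x∈F))
      ... | no x∉F = begin
        proj₁ (θ* x) ≡⟨ cong proj₁ fixed ⟩
        χ₁ x         ≡⟨ agree x x∉F ⟩
        χ₂ x         ≡⟨ cong proj₂ fixed ⟨
        proj₂ (θ* x) ∎
        where
          open ≡-Reasoning
          fixed : θ* x ≡ θ x
          fixed = S₂.retract-fixes-active D (l x) λ active →
            proj₁ (near x (ball-mono (ℕₚ.n≤1+n m) (active⇒∈ball m active))) , agree x x∉F

      onDiagonal : ∀ {χ} → Fixes (λ p → I (proj₁ p) × proj₁ p ≡ proj₂ p) θ χ →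
                   ∀ x a → χ₁ x ≡ a → χ₂ x ≡ a → I a → χ x ≡ (a , a)
      onDiagonal fix x a χ₁x≡a χ₂x≡a Ia =
        trans (fix x (subst I (sym χ₁x≡a) Ia , trans χ₁x≡a (sym χ₂x≡a)))
              (cong₂ _,_ χ₁x≡a χ₂x≡a)

      walk² : Walk G (K ²) (Fixes (λ p → I (proj₁ p) × proj₁ p ≡ proj₂ p) θ) θ θ*
      walk² = S₂.retractWalk D θ (pair-hom {K = K} hχ₁ hχ₂) l (ball F m)
                             (λ _ → active⇒∈ball m) graded

    diagonalWalk : Walk G K (Preserving I χ₁ χ₂) χ₁ χ₂
    diagonalWalk =
      endWith (mapWalk proj₁ (proj₁-hom {K = K})
                 (λ fix x a e₁ e₂ Ia → cong proj₁ (onDiagonal fix x a e₁ e₂ Ia)) walk²)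
              diagonal
      ++ʷ reverse Preserving-resp-≗
            (mapWalk proj₂ (proj₂-hom {K = K})
               (λ fix x a e₁ e₂ Ia → cong proj₂ (onDiagonal fix x a e₁ e₂ Ia)) walk²)

lemma4p7 : {τ : Signature} (n : ℕ) (ℍ : Structure τ) → Carrier ℍ ↔ Fin n →
    (J I : Pred (Carrier ℍ) 0ℓ) → J ⊆ I →
    Dismantles ℍ (λ _ → ⊤) I →
    Dismantles (ℍ ²) (λ p → I (proj₁ p) × I (proj₂ p))
                     (λ p → I (proj₁ p) × proj₁ p ≡ proj₂ p) →
    (𝔾 : Structure τ) → Countable 𝔾 → LocallyFinite 𝔾 →
    JConnected 𝔾 ℍ J
lemma4p7 n ℍ ℍ↔Fin J I J⊆I D₁ D₂ 𝔾 (code , code-injective) lf φ ψ (F , agree) =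
  toJWalk {G = 𝔾} {H = ℍ} {φ = φ} {ψ = ψ}
    (mapPred (Preserving-mono J⊆I) (φ↝φ′ ++ʷ φ′↝ψ′ ++ʷ reverse Preserving-resp-≗ ψ↝ψ′))
  where
    open Reconfiguration 𝔾 ℍ (ℕₚ.eq? (mk↣ code-injective)) (Finₚ.inj⇒≟ (↔⇒↣ ℍ↔Fin)) lf F

    k : ℕ
    k = suc (steps D₂)

    φ′ ψ′ : Carrier 𝔾 → Carrier ℍ
    φ′ = retractNear D₁ k (proj₁ φ)
    ψ′ = retractNear D₁ k (proj₁ ψ)

    φ↝φ′ : Walk 𝔾 ℍ (Preserving I (proj₁ φ) (proj₁ ψ)) (proj₁ φ) φ′
    φ↝φ′ = mapPred Fixes⇒Preservingˡ (walkToRetractNear D₁ k (proj₁ φ) (proj₂ φ))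

    ψ↝ψ′ : Walk 𝔾 ℍ (Preserving I (proj₁ φ) (proj₁ ψ)) (proj₁ ψ) ψ′
    ψ↝ψ′ = mapPred Fixes⇒Preservingʳ (walkToRetractNear D₁ k (proj₁ ψ) (proj₂ ψ))

    φ′↝ψ′ : Walk 𝔾 ℍ (Preserving I (proj₁ φ) (proj₁ ψ)) φ′ ψ′
    φ′↝ψ′ = mapPred (Preserving-Fixes (retractNear-fixes D₁ k (proj₁ φ))
                                      (retractNear-fixes D₁ k (proj₁ ψ)))
              (diagonalWalk D₂ φ′ ψ′ (lastHom φ↝φ′) (lastHom ψ↝ψ′)
                 (λ x x∉F → retractNear-cong D₁ k (proj₁ φ) (proj₁ ψ) (agree x x∉F))
                 (λ x x∈ → retractNear-∈ D₁ k (proj₁ φ) x∈ , retractNear-∈ D₁ k (proj₁ ψ) x∈))
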